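{- Let $(e_0,\dots,e_m)$ be a path in $\mathbb Z_{\mathcal S}$. Then (1) the sequence $(\eta(e_j))_{j=0}^m$ is non-decreasing and $(\zeta(e_j))_{j=0}^m$ is non-increasing for the order on primary-coloured integers, and $(e_j)_{j=0}^m$ is increasing for the order $\ge$ on $\mathbb Z_{\mathcal S}$; (2) for all $u\in\{0,\dots,m\}$, $\eta(e_u)=succ^u(\zeta(e_u))$.
   Context: $m\ge1$, $\mathcal O=\{1<\dots<m\}$, $\chi$ = truth value. Primary-coloured integers $k_{c_u}$ ($k\in\mathbb Z$, $u\in\mathcal O$), $k_{c_u}\ge l_{c_v}$ iff $k-l\ge\chi(u<v)$, $k_{c_u}>l_{c_v}$ iff $k-l\ge\chi(u\le v)$; $k_c+1=(k+1)_c$. $succ(k_{c_u})=k_{c_{u+1}}$ ($u<m$), $succ(k_{c_m})=(k+1)_{c_1}$. Secondary-coloured integers $k_{c_{x,y}}$ ($x\le y$) form $\mathbb Z_{\mathcal S}$, with $\eta(2k_{c_{x,y}})=k_{c_y}$, $\zeta(2k_{c_{x,y}})=k_{c_x}$, $\eta((2k+1)_{c_{x,y}})=(k+1)_{c_x}$, $\zeta((2k+1)_{c_{x,y}})=k_{c_y}$; each pair $(a,b)$ of primary-coloured integers with $b\le a\le b+1$ equals $(\eta(e),\zeta(e))$ for exactly one $e\in\mathbb Z_{\mathcal S}$, and $\eta(e)=succ^u(\zeta(e))$ for a unique $u\in\{0,\dots,m\}$. Order on $\mathbb Z_{\mathcal S}$: $e\ge e'$ iff $\eta(e)>\eta(e')$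 or ($\eta(e)=\eta(e')$ and $\zeta(e)\le\zeta(e')$). For $e$ with $\eta(e)=succ^u(\zeta(e))$, $u\le m-1$: $d(e)$ has $\eta=\eta(e)$, $\zeta=succ^{ -1}(\zeta(e))$; $f(e)$ has $\eta=succ(\eta(e))$, $\zeta=\zeta(e)$. A path in $\mathbb Z_{\mathcal S}$ is a sequence $(e_0,\dots,e_m)$ with $e_{j+1}\in\{d(e_j),f(e_j)\}$ (defined) for all $j<m$. -}

module Defs where

open import Data.Nat as ℕ using (ℕ; zero; suc)
open import Data.Integer as ℤ using (ℤ; +_; _-_)
open import Data.Integer.DivMod using (_/ℕ_; _%ℕ_)
open import Data.Fin as Fin using (Fin; zero; suc; toℕ; fromℕ; inject₁)
open import Data.Maybe using (Maybe; just; nothing)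
import Data.Maybe as Maybe
open import Data.Product using (_×_; _,_; ∃; Σ-syntax)
open import Data.Sum using (_⊎_)
open import Relation.Nullary using (¬_; does)
open import Relation.Binary.PropositionalEquality using (_≡_)
open import Data.Bool using (if_then_else_)

-- Throughout, m = suc n (so m ≥ 1). Colours 1..m are represented by
-- Fin (suc n), colour c_u being the element with toℕ = u - 1
-- (this shift preserves the order on colours).

Prim : ℕ → Set
Prim n = ℤ × Fin (suc n)

χ< : ∀ {n} → Fin (suc n) → Fin (suc n) → ℤ
χ< u v = if does (toℕ u ℕ.<? toℕ v) then + 1 else + 0

χ≤ : ∀ {n} → Fin (suc n) → Fin (suc n) → ℤ
χ≤ u v = if does (toℕ u ℕ.≤? toℕ v) then + 1 else + 0

_≥P_ : ∀ {n} → Prim n → Prim n → Set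
(k , u) ≥P (l , v) = χ< u v ℤ.≤ (k - l)

_>P_ : ∀ {n} → Prim n → Prim n → Set
(k , u) >P (l , v) = χ≤ u v ℤ.≤ (k - l)

_≤P_ : ∀ {n} → Prim n → Prim n → Set
a ≤P b = b ≥P a

-- successor on colour indices: nothing means "was the last colour c_m"
nextCol : ∀ {n} → Fin (suc n) → Maybe (Fin (suc n))
nextCol {zero} zero = nothing
nextCol {suc n} zero = just (suc zero)
nextCol {suc n} (suc i) = Maybe.map suc (nextCol {n} i)

succ : ∀ {n} → Prim n → Prim n
succ (k , u) with nextCol u
... | just v = (k , v)
... | nothing = (k ℤ.+ + 1 , zero)

succ⁻¹ : ∀ {n} → Prim n → Prim n
succ⁻¹ {n} (k , zero) = (k - + 1 , fromℕ n)
succ⁻¹ (k , suc i) = (k , inject₁ i)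

succ^ : ∀ {n} → ℕ → Prim n → Prim n
succ^ zero a = a
succ^ (suc u) a = succ (succ^ u a)

record ZS (n : ℕ) : Set where
  constructor sec
  field
    k : ℤ
    x : Fin (suc n)
    y : Fin (suc n)
    .x≤y : toℕ x ℕ.≤ toℕ y
open ZS public

-- η(2q_{c_{x,y}}) = q_{c_y},       ζ(2q_{c_{x,y}}) = q_{c_x},
-- η((2q+1)_{c_{x,y}}) = (q+1)_{c_x}, ζ((2q+1)_{c_{x,y}}) = q_{c_y}
η : ∀ {n} → ZS n → Prim n
η e with k e %ℕ 2
... | zero = (k e /ℕ 2 , y e)
... | suc _ = (k e /ℕ 2 ℤ.+ + 1 , x e)

ζ : ∀ {n} → ZS n → Prim n
ζ e with k e %ℕ 2
... | zero = (k e /ℕ 2 , x e)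
... | suc _ = (k e /ℕ 2 , y e)

_≥S_ : ∀ {n} → ZS n → ZS n → Set
e ≥S e' = (η e >P η e') ⊎ ((η e ≡ η e') × (ζ e ≤P ζ e'))

_>S_ : ∀ {n} → ZS n → ZS n → Set
e >S e' = (e ≥S e') × ¬ (e ≡ e')

-- d(e), f(e) are defined when η(e) = succ^u(ζ(e)) for some u ≤ m-1
Defined-df : ∀ {n} → ZS n → Set
Defined-df {n} e = ∃ λ u → (u ℕ.≤ n) × (η e ≡ succ^ u (ζ e))

IsD : ∀ {n} → ZS n → ZS n → Set
IsD e e' = Defined-df e × (η e' ≡ η e) × (ζ e' ≡ succ⁻¹ (ζ e))

IsF : ∀ {n} → ZS n → ZS n → Set
IsF e e' = Defined-df e × (η e' ≡ succ (η e)) × (ζ e' ≡ ζ e)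

-- (e_0,…,e_m) with m = suc n, given as e : ℕ → ZS n (only indices 0..m matter)
IsPath : (n : ℕ) → (ℕ → ZS n) → Set
IsPath n e = ∀ j → j ℕ.< suc n → IsD (e j) (e (suc j)) ⊎ IsF (e j) (e (suc j))

{-# OPTIONS --safe #-}

-- Say e has width t when η e = succ^ t (ζ e). A step d keeps η and moves ζ back
-- by one, a step f moves η forward and keeps ζ, so along a path η rises, ζ falls
-- and the width grows by exactly one per step. Widths are unique, since succ adds
-- one to the rank k (n + 1) + colour. As d and f only exist below width m, the m
-- steps of the path force e_0 to have width 0, hence e_u has width u.

module Submission where

open import Defs
open import Data.Nat using (ℕ; suc; _<_; _≤_)

import Data.Nat as ℕ
import Data.Nat.Properties as ℕ
open import Data.Integer as ℤ using (ℤ; +_; _-_; +≤+)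
import Data.Integer.Properties as ℤ
open import Data.Integer.Tactic.RingSolver using (solve-∀)
open import Algebra.Properties.AbelianGroup ℤ.+-0-abelianGroup using (∙-cancelʳ)
open import Data.Fin using (Fin; zero; suc; toℕ; fromℕ; inject₁)
import Data.Fin.Properties as Fin
open import Data.Maybe using (just; nothing)
open import Function using (_∘_)
open import Data.Bool using (true; false; if_then_else_)
open import Data.Product using (_×_; _,_)
open import Data.Sum using (_⊎_; inj₁; inj₂)
open import Relation.Nullary using (¬_; contradiction)
open import Relation.Nullary.Decidable using (dec-false)
open import Relation.Binary.PropositionalEquality
  using (_≡_; _≢_; refl; sym; trans; cong; subst; module ≡-Reasoning)

private
  variable
    n t t′ : ℕ
    e e′ : ZS n

toℕ-nextCol : ∀ {n} {u v : Fin (suc n)} → nextCol u ≡ just v → toℕ v ≡ suc (toℕ u)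
toℕ-nextCol {n = ℕ.zero} {u = zero} ()
toℕ-nextCol {n = suc n} {u = zero} refl = refl
toℕ-nextCol {n = suc n} {u = suc i} eq with nextCol i in eqᵢ
toℕ-nextCol {n = suc n} {u = suc i} refl | just w = cong suc (toℕ-nextCol eqᵢ)

nextCol≡nothing⇒toℕ≡n : ∀ {n} {u : Fin (suc n)} → nextCol u ≡ nothing → toℕ u ≡ n
nextCol≡nothing⇒toℕ≡n {n = ℕ.zero} {u = zero} _ = refl
nextCol≡nothing⇒toℕ≡n {n = suc n} {u = suc i} eq with nextCol i in eqᵢ
... | nothing = cong suc (nextCol≡nothing⇒toℕ≡n eqᵢ)

data SuccView {n} (k : ℤ) (u : Fin (suc n)) : Prim n → Set where
  within : ∀ {v} → toℕ v ≡ suc (toℕ u) → SuccView k u (k , v)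
  wrap   : toℕ u ≡ n → SuccView k u (k ℤ.+ + 1 , zero)

succView : ∀ k (u : Fin (suc n)) → SuccView k u (succ (k , u))
succView k u with nextCol u in eq
... | just v  = within (toℕ-nextCol eq)
... | nothing = wrap (nextCol≡nothing⇒toℕ≡n eq)

succ-succ⁻¹ : (a : Prim n) → succ (succ⁻¹ a) ≡ a
succ-succ⁻¹ {n} (k , zero) with succ (k - + 1 , fromℕ n) | succView (k - + 1) (fromℕ n)
... | _ | within {v} eq =
  contradiction (trans eq (cong suc (Fin.toℕ-fromℕ n))) (ℕ.<⇒≢ (Fin.toℕ<n v))
... | _ | wrap _ = cong (_, zero) (minus-plus k)
  where
  minus-plus : ∀ k → (k - + 1) ℤ.+ + 1 ≡ k
  minus-plus = solve-∀
succ-succ⁻¹ (k , suc i) with succ (k , inject₁ i) | succView k (inject₁ i)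
... | _ | within eq =
  cong (k ,_) (Fin.toℕ-injective (trans eq (cong suc (Fin.toℕ-inject₁ i))))
... | _ | wrap eq =
  contradiction (trans (sym (Fin.toℕ-inject₁ i)) eq) (ℕ.<⇒≢ (Fin.toℕ<n i))

succ^-succ : ∀ t (a : Prim n) → succ^ t (succ a) ≡ succ (succ^ t a)
succ^-succ ℕ.zero    a = refl
succ^-succ (suc t) a = cong succ (succ^-succ t a)

rank : Prim n → ℤ
rank {n} (k , c) = k ℤ.* + suc n ℤ.+ + toℕ c

rank-succ : (a : Prim n) → rank (succ a) ≡ ℤ.suc (rank a)
rank-succ {n} (k , u) with succ (k , u) | succView k u
... | _ | within eq rewrite eq = next-colour (k ℤ.* + suc n) (+ toℕ u)
  where
  next-colour : ∀ r c → r ℤ.+ (+ 1 ℤ.+ c) ≡ + 1 ℤ.+ (r ℤ.+ c)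
  next-colour = solve-∀
... | _ | wrap eq rewrite eq = next-level k (+ n)
  where
  next-level : ∀ k c →
    (k ℤ.+ + 1) ℤ.* (+ 1 ℤ.+ c) ℤ.+ + 0 ≡ + 1 ℤ.+ (k ℤ.* (+ 1 ℤ.+ c) ℤ.+ c)
  next-level = solve-∀

rank-succ^ : ∀ t (a : Prim n) → rank (succ^ t a) ≡ + t ℤ.+ rank a
rank-succ^ ℕ.zero  a = sym (ℤ.+-identityˡ (rank a))
rank-succ^ (suc t) a = begin
  rank (succ (succ^ t a))   ≡⟨ rank-succ (succ^ t a) ⟩
  ℤ.suc (rank (succ^ t a))  ≡⟨ cong ℤ.suc (rank-succ^ t a) ⟩
  ℤ.suc (+ t ℤ.+ rank a)    ≡⟨ sym (ℤ.suc-+ t (rank a)) ⟩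
  + suc t ℤ.+ rank a        ∎
  where open ≡-Reasoning

succ^-injectiveˡ : ∀ t t′ (a : Prim n) → succ^ t a ≡ succ^ t′ a → t ≡ t′
succ^-injectiveˡ t t′ a eq = ℤ.+-injective (∙-cancelʳ (rank a) (+ t) (+ t′) (begin
  + t ℤ.+ rank a    ≡⟨ rank-succ^ t a ⟨
  rank (succ^ t a)  ≡⟨ cong rank eq ⟩
  rank (succ^ t′ a) ≡⟨ rank-succ^ t′ a ⟩
  + t′ ℤ.+ rank a   ∎))
  where open ≡-Reasoning

succ≢ : (a : Prim n) → succ a ≢ a
succ≢ a eq = ℤ.i≢suc[i] (sym (trans (sym (rank-succ a)) (cong rank eq)))

succ⁻¹≢ : (a : Prim n) → succ⁻¹ a ≢ a
succ⁻¹≢ a eq = succ≢ a (trans (cong succ (sym eq)) (succ-succ⁻¹ a))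

χ<≡0 : ∀ {n} {u v : Fin (suc n)} → ¬ toℕ u < toℕ v → χ< u v ≡ + 0
χ<≡0 {u = u} {v} u≮v = cong (if_then + 1 else + 0) (dec-false (toℕ u ℕ.<? toℕ v) u≮v)

χ≤≡0 : ∀ {n} {u v : Fin (suc n)} → ¬ toℕ u ≤ toℕ v → χ≤ u v ≡ + 0
χ≤≡0 {u = u} {v} u≰v = cong (if_then + 1 else + 0) (dec-false (toℕ u ℕ.≤? toℕ v) u≰v)

if-then-1-else-0≤1 : ∀ b → (if b then + 1 else + 0) ℤ.≤ + 1
if-then-1-else-0≤1 true  = ℤ.≤-refl
if-then-1-else-0≤1 false = +≤+ ℕ.z≤n

≥P-sameLevel : ∀ k (u v : Fin (suc n)) → toℕ v ≤ toℕ u → (k , u) ≥P (k , v)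
≥P-sameLevel k u v v≤u rewrite χ<≡0 (ℕ.≤⇒≯ v≤u) | ℤ.+-inverseʳ k = ℤ.≤-refl

>P-sameLevel : ∀ k (u v : Fin (suc n)) → toℕ v < toℕ u → (k , u) >P (k , v)
>P-sameLevel k u v v<u rewrite χ≤≡0 (ℕ.<⇒≱ v<u) | ℤ.+-inverseʳ k = ℤ.≤-refl

≥P-nextLevel : ∀ k l (u v : Fin (suc n)) → k - l ≡ + 1 → (k , u) ≥P (l , v)
≥P-nextLevel k l u v eq = subst (_ ℤ.≤_) (sym eq) (if-then-1-else-0≤1 _)

>P-nextLevel : ∀ k l (u v : Fin (suc n)) → k - l ≡ + 1 → (k , u) >P (l , v)
>P-nextLevel k l u v eq = subst (_ ℤ.≤_) (sym eq) (if-then-1-else-0≤1 _)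

[k+1]-k≡1 : ∀ k → (k ℤ.+ + 1) - k ≡ + 1
[k+1]-k≡1 = solve-∀

≥P-refl : (a : Prim n) → a ≥P a
≥P-refl (k , u) = ≥P-sameLevel k u u ℕ.≤-refl

succ-≥P : (a : Prim n) → succ a ≥P a
succ-≥P (k , u) with succ (k , u) | succView k u
... | _ | within {v} eq = ≥P-sameLevel k v u (subst (toℕ u ≤_) (sym eq) (ℕ.n≤1+n _))
... | _ | wrap _        = ≥P-nextLevel (k ℤ.+ + 1) k zero u ([k+1]-k≡1 k)

succ->P : (a : Prim n) → succ a >P a
succ->P (k , u) with succ (k , u) | succView k u
... | _ | within {v} eq = >P-sameLevel k v u (subst (toℕ u <_) (sym eq) (ℕ.n<1+n _))
... | _ | wrap _        = >P-nextLevel (k ℤ.+ + 1) k zero u ([k+1]-k≡1 k)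

≥P-succ⁻¹ : (a : Prim n) → a ≥P succ⁻¹ a
≥P-succ⁻¹ {n} (k , zero) = ≥P-nextLevel k (k - + 1) zero (fromℕ n) (k-[k-1]≡1 k)
  where
  k-[k-1]≡1 : ∀ k → k - (k - + 1) ≡ + 1
  k-[k-1]≡1 = solve-∀
≥P-succ⁻¹ (k , suc i) =
  ≥P-sameLevel k (suc i) (inject₁ i)
    (subst (_≤ suc (toℕ i)) (sym (Fin.toℕ-inject₁ i)) (ℕ.n≤1+n _))

Step : ZS n → ZS n → Set
Step e e′ = IsD e e′ ⊎ IsF e e′

HasWidth : ℕ → ZS n → Set
HasWidth t e = η e ≡ succ^ t (ζ e)

step-defined : Step e e′ → Defined-df e
step-defined (inj₁ (def , _)) = def
step-defined (inj₂ (def , _)) = def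

step-η : Step e e′ → η e′ ≥P η e
step-η {e = e} (inj₁ (_ , η≡ , _)) = subst (_≥P η e) (sym η≡) (≥P-refl (η e))
step-η {e = e} (inj₂ (_ , η≡ , _)) = subst (_≥P η e) (sym η≡) (succ-≥P (η e))

step-ζ : Step e e′ → ζ e ≥P ζ e′
step-ζ {e = e} (inj₁ (_ , _ , ζ≡)) = subst (ζ e ≥P_) (sym ζ≡) (≥P-succ⁻¹ (ζ e))
step-ζ {e = e} (inj₂ (_ , _ , ζ≡)) = subst (ζ e ≥P_) (sym ζ≡) (≥P-refl (ζ e))

step->S : Step e e′ → e′ >S e
step->S {e = e} (inj₁ (_ , η≡ , ζ≡)) =
    inj₂ (η≡ , subst (ζ e ≥P_) (sym ζ≡) (≥P-succ⁻¹ (ζ e)))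
  , λ e′≡e → succ⁻¹≢ (ζ e) (trans (sym ζ≡) (cong ζ e′≡e))
step->S {e = e} (inj₂ (_ , η≡ , _)) =
    inj₁ (subst (_>P η e) (sym η≡) (succ->P (η e)))
  , λ e′≡e → succ≢ (η e) (trans (sym η≡) (cong η e′≡e))

step-width : ∀ t → Step e e′ → HasWidth t e → HasWidth (suc t) e′
step-width {e = e} {e′} t (inj₁ (_ , η≡ , ζ≡)) w = begin
  η e′                              ≡⟨ η≡ ⟩
  η e                               ≡⟨ w ⟩
  succ^ t (ζ e)                     ≡⟨ cong (succ^ t) (succ-succ⁻¹ (ζ e)) ⟨
  succ^ t (succ (succ⁻¹ (ζ e)))     ≡⟨ succ^-succ t (succ⁻¹ (ζ e)) ⟩
  succ (succ^ t (succ⁻¹ (ζ e)))     ≡⟨ cong (succ ∘ succ^ t) ζ≡ ⟨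
  succ (succ^ t (ζ e′))             ∎
  where open ≡-Reasoning
step-width {e = e} {e′} t (inj₂ (_ , η≡ , ζ≡)) w = begin
  η e′                   ≡⟨ η≡ ⟩
  succ (η e)             ≡⟨ cong succ w ⟩
  succ (succ^ t (ζ e))   ≡⟨ cong (succ ∘ succ^ t) ζ≡ ⟨
  succ (succ^ t (ζ e′))  ∎
  where open ≡-Reasoning

width-unique : HasWidth t e → HasWidth t′ e → t ≡ t′
width-unique {t = t} {e = e} {t′} w w′ = succ^-injectiveˡ t t′ (ζ e) (trans (sym w) w′)

path-width-from : ∀ (e : ℕ → ZS n) → IsPath n e → ∀ t → HasWidth t (e 0) →
                  ∀ j → j ≤ suc n → HasWidth (t ℕ.+ j) (e j)
path-width-from e path t w ℕ.zero    _   rewrite ℕ.+-identityʳ t = w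
path-width-from e path t w (suc j) j<m rewrite ℕ.+-suc t j =
  step-width (t ℕ.+ j) (path j j<m) (path-width-from e path t w j (ℕ.<⇒≤ j<m))

path-width : ∀ (e : ℕ → ZS n) → IsPath n e → ∀ j → j ≤ suc n → HasWidth j (e j)
path-width {n} e path j j≤m
  with step-defined (path 0 ℕ.z<s) | step-defined (path n (ℕ.n<1+n n))
... | t₀ , _ , w₀ | t , t≤n , w =
  subst (λ s → HasWidth (s ℕ.+ j) (e j)) t₀≡0 (from-start j j≤m)
  where
  from-start : ∀ j → j ≤ suc n → HasWidth (t₀ ℕ.+ j) (e j)
  from-start = path-width-from e path t₀ w₀
  -- e n has width t₀ + n, while d and f are only defined at widths ≤ n.
  t₀≡0 : t₀ ≡ 0
  t₀≡0 = ℕ.n≤0⇒n≡0 (ℕ.+-cancelʳ-≤ n t₀ 0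
    (subst (_≤ n) (width-unique w (from-start n (ℕ.n≤1+n n))) t≤n))

lemma5p6 : (n : ℕ) (e : ℕ → ZS n) → IsPath n e →
    ((∀ j → j < suc n → η (e (suc j)) ≥P η (e j))
     × (∀ j → j < suc n → ζ (e j) ≥P ζ (e (suc j)))
     × (∀ j → j < suc n → e (suc j) >S e j))
    × (∀ u → u ≤ suc n → η (e u) ≡ succ^ u (ζ (e u)))
lemma5p6 n e path =
    ( (λ j j<m → step-η (path j j<m))
    , (λ j j<m → step-ζ (path j j<m))
    , (λ j j<m → step->S (path j j<m)) )
  , path-width e path
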